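{- For a Packed Memory Array holding $n$ elements, the span of the parallel counting algorithm used in the counting phase of the batch-insert algorithm is $O(\log^2(n))$.
   Context: A Packed Memory Array (PMA) stores $n$ elements in sorted order in an array of $\Theta(n)$ cells divided into leaves of $\Theta(\log n)$ cells, with an implicit complete binary tree over the leaves (height $O(\log n)$); each node covers a contiguous range of cells, its density is (filled cells)/(cells in range), and each level has an upper density bound; a node exceeding it violates its density bound. The parallel counting algorithm, given the set of leaves modified by a batch merge, processes tree levels serially bottom-up: it keeps a thread-safe set of nodes to count at the current level, initialized with the modified leaves; all nodes of the current level are processed in parallel; the density of an internal node is obtained by combining cached counts of its children when both are cached, and otherwise the uncounted child is counted by a parallel top-down recursion through its subtree that stops at any node whose count is cached and counts leaves (checking their cells in parallel) when reached without a cached result; all counts are cached; if a node violates its bound, its parent is added to the set for the next level. It terminates when the set is empty or the root has been processed. Span is measured in the work-span model. -}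

module Defs where

open import Data.Nat using (ℕ; zero; suc; _+_; _*_; _^_; _⊔_; _<ᵇ_; ⌊_/2⌋)
open import Data.Nat.Properties using (_≟_)
open import Data.Nat.Logarithm using (⌈log₂_⌉)
open import Data.Bool using (Bool; true; false; if_then_else_)
open import Data.Maybe using (Maybe; just; nothing)
open import Data.List using (List; []; _∷_; length; deduplicate)
open import Data.Product using (_×_; _,_)
open import Relation.Nullary using (yes; no)

-- The array is split into 2 ^ height leaves of leafSize cells each;
-- leaf j, position k (j < 2 ^ height, k < leafSize) is filled iff
-- cell j k = true.  A tree node is (level ℓ, index i) with ℓ ≤ height,
-- i < 2 ^ (height ∸ ℓ); it covers leaves i*2^ℓ .. (i+1)*2^ℓ - 1;
-- level 0 = leaves, level height = root.  Children of (ℓ+1,i) are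
-- (ℓ,2i) and (ℓ,2i+1); parent of (ℓ,i) is (ℓ+1,⌊i/2⌋).
-- The upper density bound of level ℓ is upperNum ℓ / upperDen ℓ.

record PMA : Set where
  field
    height   : ℕ
    leafSize : ℕ
    cell     : ℕ → ℕ → Bool
    upperNum : ℕ → ℕ
    upperDen : ℕ → ℕ
open PMA public

bit : Bool → ℕ
bit true  = 1
bit false = 0

sumBelow : ℕ → (ℕ → ℕ) → ℕ
sumBelow zero    f = 0
sumBelow (suc m) f = sumBelow m f + f m

leafCount : PMA → ℕ → ℕ
leafCount P j = sumBelow (leafSize P) (λ k → bit (cell P j k))

numElements : PMA → ℕ
numElements P = sumBelow (2 ^ height P) (leafCount P)

nodeCells : PMA → ℕ → ℕ
nodeCells P ℓ = leafSize P * 2 ^ ℓ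

violates : PMA → ℕ → ℕ → Bool
violates P ℓ v = (upperNum P ℓ * nodeCells P ℓ) <ᵇ (upperDen P ℓ * v)

-- Cache of counts: level → index → cached count (if any)

Cache : Set
Cache = ℕ → ℕ → Maybe ℕ

emptyCache : Cache
emptyCache _ _ = nothing

store : Cache → ℕ → ℕ → ℕ → Cache
store c ℓ i v ℓ' i' with ℓ ≟ ℓ' | i ≟ i'
... | yes _ | yes _ = just v
... | _     | _     = c ℓ' i'

-- Work-span cost model (unit-cost primitives):
--  * an O(1) step (cache lookup / cache write / addition / comparison /
--    insertion into the thread-safe set) has span 1;
--  * a parallel loop over k items (binary forking) has span
--    ⌈log₂ k⌉ + 1 + (maximum span of an iteration);
--  * spawning two tasks in parallel has span 1 + max of both spans.

parSpan : ℕ → ℕ → ℕ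
parSpan k m = ⌈log₂ k ⌉ + 1 + m

-- Returns (count , span , new cache).  Sibling subtrees are
-- disjoint, so threading the cache left-to-right is equivalent to the
-- parallel execution; the span uses the max of both branches.
countRec : PMA → ℕ → ℕ → Cache → ℕ × ℕ × Cache
countRec P ℓ i c with c ℓ i
countRec P ℓ       i c | just v  = v , 1 , c
countRec P zero    i c | nothing =
  leafCount P i , parSpan (leafSize P) 1 + 1 , store c zero i (leafCount P i)
countRec P (suc ℓ) i c | nothing with countRec P ℓ (2 * i) c
... | vl , sl , c₁ with countRec P ℓ (suc (2 * i)) c₁
... | vr , sr , c₂ =
  vl + vr , 1 + (sl ⊔ sr) + 1 , store c₂ (suc ℓ) i (vl + vr)

-- For each node:
-- compute its count (combining cached child counts if both cached, else
-- counting the uncounted child top-down — exactly what countRec does at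
-- an uncached internal node), then, if it violates its density bound,
-- add its parent to the next-level set (span 1).
-- Returns (max iteration span , parents to add , cache).
levelBody : PMA → ℕ → List ℕ → Cache → ℕ × List ℕ × Cache
levelBody P ℓ []       c = 0 , [] , c
levelBody P ℓ (i ∷ is) c with countRec P ℓ i c
... | v , sp , c₁ with levelBody P ℓ is c₁
... | m , nxt , c₂ =
  (sp + 1) ⊔ m , (if violates P ℓ v then ⌊ i /2⌋ ∷ nxt else nxt) , c₂

-- Thread-safe set: duplicates are removed.
asSet : List ℕ → List ℕ
asSet = deduplicate _≟_

-- Serial bottom-up loop over levels ℓ, ℓ+1, …; fuel = number of levels
-- still available (so the loop stops after the root level).  Stops when
-- the set is empty.  Returns the total span.
runLevels : PMA → ℕ → ℕ → List ℕ → Cache → ℕ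
runLevels P zero     ℓ S        c = 0
runLevels P (suc f)  ℓ []       c = 0
runLevels P (suc f)  ℓ (i ∷ is) c with levelBody P ℓ (i ∷ is) c
... | m , nxt , c₁ =
  parSpan (length (i ∷ is)) m + runLevels P f (suc ℓ) (asSet nxt) c₁

-- Span of the parallel counting algorithm, given the (indices of the)
-- leaves modified by the batch merge.
countingSpan : PMA → List ℕ → ℕ
countingSpan P modified =
  runLevels P (suc (height P)) 0 (asSet modified) emptyCache

{-# OPTIONS --safe #-}
-- Processing one level forks over the current set, which consists of distinct
-- node indices below 2 ^ h and so costs at most h, and then runs counting
-- recursions from level ℓ; each descends to the leaves at cost 2 per level and
-- ends in a leaf scan of cost ⌈log₂ s⌉ + 3.  Hence every level has span
-- O(h + log s), and there are at most h + 1 levels.  The hypotheses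
-- s · 2 ^ h ≤ C · n and s ≤ C · ⌈log₂ n⌉ make both h and ⌈log₂ s⌉ O(log n).
module Submission where

open import Defs
open import Data.Nat using (ℕ; _+_; _*_; _^_; _≤_; _<_; zero; suc; z≤n; s≤s; s≤s⁻¹; _⊔_; NonZero; >-nonZero)
open import Data.Nat.Properties
open import Data.Nat.Logarithm using (⌈log₂_⌉; ⌈log₂⌉-mono-≤; ⌈log₂2^n⌉≡n; ⌈log₂2*n⌉≡1+⌈log₂n⌉)
open import Data.Nat.Tactic.RingSolver using (solve-∀)
open import Data.List using (List; []; _∷_; length; lookup; deduplicate)
open import Data.List.Membership.Propositional.Properties using (∈-lookup)
open import Data.List.Relation.Unary.All as All using (All; []; _∷_)
open import Data.List.Relation.Unary.All.Properties using (deduplicate⁺)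
open import Data.List.Relation.Unary.AllPairs using (_∷_)
open import Data.List.Relation.Unary.Unique.Propositional using (Unique)
open import Data.List.Relation.Unary.Unique.DecPropositional.Properties using (deduplicate-!)
open import Data.Product using (∃-syntax; _,_; proj₁; proj₂)
open import Data.Bool using (true; false)
open import Data.Maybe using (just; nothing)
open import Data.Fin as Fin using (Fin; fromℕ<; toℕ)
open import Data.Fin.Properties using (injective⇒≤; toℕ-fromℕ<)
open import Function.Definitions using (Injective)
open import Relation.Binary.PropositionalEquality
open import Data.Empty using (⊥-elim)

lookup-injective : ∀ {xs : List ℕ} → Unique xs → Injective _≡_ _≡_ (lookup xs)
lookup-injective (_  ∷ _) {Fin.zero}  {Fin.zero}  _  = refl
lookup-injective (x∉ ∷ _) {Fin.zero}  {Fin.suc j} eq = ⊥-elim (All.lookup x∉ (∈-lookup j) eq)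
lookup-injective (x∉ ∷ _) {Fin.suc i} {Fin.zero}  eq = ⊥-elim (All.lookup x∉ (∈-lookup i) (sym eq))
lookup-injective (_  ∷ u) {Fin.suc i} {Fin.suc j} eq = cong Fin.suc (lookup-injective u eq)

unique-length≤ : ∀ {b} {xs : List ℕ} → Unique xs → All (_< b) xs → length xs ≤ b
unique-length≤ {b} {xs} unique below = injective⇒≤ {f = embed} embed-injective
  where
  embed : Fin (length xs) → Fin b
  embed k = fromℕ< (All.lookup below (∈-lookup k))

  embed-injective : Injective _≡_ _≡_ embed
  embed-injective {i} {j} eq = lookup-injective unique (begin
    lookup xs i          ≡⟨ sym (toℕ-fromℕ< (All.lookup below (∈-lookup i))) ⟩
    toℕ (embed i)        ≡⟨ cong toℕ eq ⟩
    toℕ (embed j)        ≡⟨ toℕ-fromℕ< (All.lookup below (∈-lookup j)) ⟩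
    lookup xs j          ∎)
    where open ≡-Reasoning

n<2^n : ∀ n → n < 2 ^ n
n<2^n zero    = s≤s z≤n
n<2^n (suc n) = +-mono-≤ (m^n>0 2 n) (≤-trans (n<2^n n) (m≤m+n (2 ^ n) 0))

⌈log₂n⌉≤n : ∀ n → ⌈log₂ n ⌉ ≤ n
⌈log₂n⌉≤n n = ≤-trans (⌈log₂⌉-mono-≤ (<⇒≤ (n<2^n n))) (≤-reflexive (⌈log₂2^n⌉≡n n))

⌈log₂[2^k*n]⌉≡k+⌈log₂n⌉ : ∀ k n .{{_ : NonZero n}} → ⌈log₂ (2 ^ k * n) ⌉ ≡ k + ⌈log₂ n ⌉
⌈log₂[2^k*n]⌉≡k+⌈log₂n⌉ zero    n = cong ⌈log₂_⌉ (*-identityˡ n)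
⌈log₂[2^k*n]⌉≡k+⌈log₂n⌉ (suc k) n = begin
  ⌈log₂ (2 * 2 ^ k * n) ⌉    ≡⟨ cong ⌈log₂_⌉ (*-assoc 2 (2 ^ k) n) ⟩
  ⌈log₂ (2 * (2 ^ k * n)) ⌉  ≡⟨ ⌈log₂2*n⌉≡1+⌈log₂n⌉ (2 ^ k * n) {{m*n≢0 (2 ^ k) n {{m^n≢0 2 k}}}} ⟩
  suc ⌈log₂ (2 ^ k * n) ⌉    ≡⟨ cong suc (⌈log₂[2^k*n]⌉≡k+⌈log₂n⌉ k n) ⟩
  suc (k + ⌈log₂ n ⌉)        ∎
  where open ≡-Reasoning

1+[2*ℓ+b]+1≡2*[1+ℓ]+b : ∀ ℓ b → 1 + (2 * ℓ + b) + 1 ≡ 2 * suc ℓ + b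
1+[2*ℓ+b]+1≡2*[1+ℓ]+b = solve-∀

module _ (P : PMA) where

  leafSpan : ℕ
  leafSpan = parSpan (leafSize P) 1 + 1

  countRec-span≤ : ∀ ℓ i c → proj₁ (proj₂ (countRec P ℓ i c)) ≤ 2 * ℓ + leafSpan
  countRec-span≤ ℓ i c with c ℓ i
  countRec-span≤ ℓ       i c | just _  = ≤-trans (m≤n+m 1 (parSpan (leafSize P) 1)) (m≤n+m leafSpan (2 * ℓ))
  countRec-span≤ zero    i c | nothing = ≤-refl
  countRec-span≤ (suc ℓ) i c | nothing
    with countRec P ℓ (2 * i) c | countRec-span≤ ℓ (2 * i) c
  ... | _ , sl , c₁ | sl≤ with countRec P ℓ (suc (2 * i)) c₁ | countRec-span≤ ℓ (suc (2 * i)) c₁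
  ... | _ , sr , _  | sr≤ = begin
    1 + (sl ⊔ sr) + 1               ≤⟨ +-monoˡ-≤ 1 (+-monoʳ-≤ 1 (⊔-lub sl≤ sr≤)) ⟩
    1 + (2 * ℓ + leafSpan) + 1      ≡⟨ 1+[2*ℓ+b]+1≡2*[1+ℓ]+b ℓ leafSpan ⟩
    2 * suc ℓ + leafSpan            ∎
    where open ≤-Reasoning

  levelBody-span≤ : ∀ ℓ is c → proj₁ (levelBody P ℓ is c) ≤ suc (2 * ℓ + leafSpan)
  levelBody-span≤ ℓ []       c = z≤n
  levelBody-span≤ ℓ (i ∷ is) c with countRec P ℓ i c | countRec-span≤ ℓ i c
  ... | _ , sp , c₁ | sp≤ with levelBody P ℓ is c₁ | levelBody-span≤ ℓ is c₁
  ... | _ , _ , _   | m≤  = ⊔-lub (≤-trans (≤-reflexive (+-comm sp 1)) (s≤s sp≤)) m≤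

  levelBody-parents< : ∀ {b} ℓ is c → All (_< b) is → All (_< b) (proj₁ (proj₂ (levelBody P ℓ is c)))
  levelBody-parents< ℓ []       c []             = []
  levelBody-parents< ℓ (i ∷ is) c (i<b ∷ below) with countRec P ℓ i c
  ... | v , _ , c₁ with levelBody P ℓ is c₁ | levelBody-parents< ℓ is c₁ below
  ... | _ , _ , _  | parents< with violates P ℓ v
  ... | true  = ≤-<-trans (⌊n/2⌋≤n i) i<b ∷ parents<
  ... | false = parents<

  levelSpanBound : ℕ
  levelSpanBound = height P + 1 + suc (2 * height P + leafSpan)

  runLevels-span≤ : ∀ f ℓ S c → All (_< 2 ^ height P) S → Unique S → ℓ + f ≤ suc (height P) →
                    runLevels P f ℓ S c ≤ f * levelSpanBound
  runLevels-span≤ zero    ℓ S        c _ _ _ = z≤n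
  runLevels-span≤ (suc f) ℓ []       c _ _ _ = z≤n
  runLevels-span≤ (suc f) ℓ (i ∷ is) c below unique fuel = +-mono-≤ level-span≤ rest-span≤
    where
    m : ℕ
    m = proj₁ (levelBody P ℓ (i ∷ is) c)

    parents : List ℕ
    parents = proj₁ (proj₂ (levelBody P ℓ (i ∷ is) c))

    ℓ+f≤h : ℓ + f ≤ height P
    ℓ+f≤h = s≤s⁻¹ (≤-trans (≤-reflexive (sym (+-suc ℓ f))) fuel)

    ℓ≤h : ℓ ≤ height P
    ℓ≤h = ≤-trans (m≤m+n ℓ f) ℓ+f≤h

    log-length≤ : ⌈log₂ length (i ∷ is) ⌉ ≤ height P
    log-length≤ = ≤-trans (⌈log₂⌉-mono-≤ (unique-length≤ unique below)) (≤-reflexive (⌈log₂2^n⌉≡n (height P)))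

    level-span≤ : parSpan (length (i ∷ is)) m ≤ levelSpanBound
    level-span≤ = +-mono-≤ (+-monoˡ-≤ 1 log-length≤)
                    (≤-trans (levelBody-span≤ ℓ (i ∷ is) c) (s≤s (+-monoˡ-≤ leafSpan (*-monoʳ-≤ 2 ℓ≤h))))

    rest-span≤ : runLevels P f (suc ℓ) (deduplicate _≟_ parents) (proj₂ (proj₂ (levelBody P ℓ (i ∷ is) c)))
                 ≤ f * levelSpanBound
    rest-span≤ = runLevels-span≤ f (suc ℓ) (deduplicate _≟_ parents) _
                   (deduplicate⁺ _≟_ (levelBody-parents< ℓ (i ∷ is) c below)) (deduplicate-! _≟_ parents) (s≤s ℓ+f≤h)

  countingSpan≤ : ∀ modified → All (_< 2 ^ height P) modified →
                  countingSpan P modified ≤ suc (height P) * levelSpanBound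
  countingSpan≤ modified below = runLevels-span≤ (suc (height P)) 0 (deduplicate _≟_ modified) emptyCache
    (deduplicate⁺ _≟_ below) (deduplicate-! _≟_ modified) ≤-refl

span-quadratic≤ : ∀ {h g k L} → 1 ≤ k * L → h ≤ k * L → g ≤ k * L →
                  suc h * (h + 1 + suc (2 * h + (g + 1 + 1 + 1))) ≤ 18 * (k * k) * (L * L)
span-quadratic≤ {h} {g} {k} {L} 1≤u h≤u g≤u = begin
  suc h * (h + 1 + suc (2 * h + (g + 1 + 1 + 1)))  ≡⟨ cong (suc h *_) (normalise h g) ⟩
  suc h * (3 * h + g + 5)                           ≤⟨ *-mono-≤ (+-mono-≤ 1≤u h≤u)
                                                         (+-mono-≤ (+-mono-≤ (*-monoʳ-≤ 3 h≤u) g≤u) (*-monoʳ-≤ 5 1≤u)) ⟩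
  (u + u) * (3 * u + u + 5 * u)                     ≡⟨ square k L ⟩
  18 * (k * k) * (L * L)                            ∎
  where
  open ≤-Reasoning
  u : ℕ
  u = k * L

  normalise : ∀ h g → h + 1 + suc (2 * h + (g + 1 + 1 + 1)) ≡ 3 * h + g + 5
  normalise = solve-∀

  square : ∀ k L → (k * L + k * L) * (3 * (k * L) + k * L + 5 * (k * L)) ≡ 18 * (k * k) * (L * L)
  square = solve-∀

height≤ : ∀ C (P : PMA) .{{_ : NonZero (numElements P)}} → 1 ≤ leafSize P →
          leafSize P * 2 ^ height P ≤ C * numElements P → height P ≤ C + ⌈log₂ numElements P ⌉
height≤ C P 1≤s capacity = begin
  height P                          ≡⟨ sym (⌈log₂2^n⌉≡n (height P)) ⟩
  ⌈log₂ (2 ^ height P) ⌉            ≤⟨ ⌈log₂⌉-mono-≤ 2^h≤2^C*n ⟩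
  ⌈log₂ (2 ^ C * numElements P) ⌉   ≡⟨ ⌈log₂[2^k*n]⌉≡k+⌈log₂n⌉ C (numElements P) ⟩
  C + ⌈log₂ numElements P ⌉         ∎
  where
  open ≤-Reasoning
  2^h≤2^C*n : 2 ^ height P ≤ 2 ^ C * numElements P
  2^h≤2^C*n = ≤-trans (m≤n*m (2 ^ height P) (leafSize P) {{>-nonZero 1≤s}})
                (≤-trans capacity (*-monoˡ-≤ (numElements P) (<⇒≤ (n<2^n C))))

countingSpan≤log² : ∀ C (P : PMA) modified → All (_< 2 ^ height P) modified →
                    2 ≤ numElements P → 1 ≤ leafSize P →
                    leafSize P * 2 ^ height P ≤ C * numElements P →
                    leafSize P ≤ C * ⌈log₂ numElements P ⌉ →
                    countingSpan P modified ≤ 18 * (suc C * suc C) * (⌈log₂ numElements P ⌉ * ⌈log₂ numElements P ⌉)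
countingSpan≤log² C P modified below 2≤n 1≤s capacity s≤ = begin
  countingSpan P modified                ≤⟨ countingSpan≤ P modified below ⟩
  suc (height P) * levelSpanBound P      ≤⟨ span-quadratic≤ {k = suc C} {L} 1≤u h≤u log-s≤u ⟩
  18 * (suc C * suc C) * (L * L)         ∎
  where
  open ≤-Reasoning
  instance
    n≢0 : NonZero (numElements P)
    n≢0 = >-nonZero (≤-trans (s≤s z≤n) 2≤n)

  L : ℕ
  L = ⌈log₂ numElements P ⌉

  u : ℕ
  u = suc C * L

  1≤L : 1 ≤ L
  1≤L = ⌈log₂⌉-mono-≤ 2≤n

  1≤u : 1 ≤ u
  1≤u = ≤-trans 1≤L (m≤m+n L (C * L))

  h≤u : height P ≤ u
  h≤u = begin
    height P   ≤⟨ height≤ C P 1≤s capacity ⟩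
    C + L      ≡⟨ +-comm C L ⟩
    L + C      ≤⟨ +-monoʳ-≤ L (m≤m*n C L {{>-nonZero 1≤L}}) ⟩
    L + C * L  ∎

  log-s≤u : ⌈log₂ leafSize P ⌉ ≤ u
  log-s≤u = ≤-trans (⌈log₂n⌉≤n (leafSize P)) (≤-trans s≤ (m≤n+m (C * L) L))

mainTheorem4 : (C : ℕ) →
    ∃[ c ] ∃[ n₀ ]
      ((P : PMA) (modified : List ℕ) →
        All (_< 2 ^ height P) modified →
        n₀ ≤ numElements P →
        1 ≤ leafSize P →
        leafSize P * 2 ^ height P ≤ C * numElements P →
        leafSize P ≤ C * ⌈log₂ numElements P ⌉ →
        countingSpan P modified ≤ c * (⌈log₂ numElements P ⌉ * ⌈log₂ numElements P ⌉))
mainTheorem4 C = 18 * (suc C * suc C) , 2 , countingSpan≤log² C
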